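{- Let $A,a$ be positive integers. As formal power series in $q$, $$\sum_{n\geq0}p_{A,a}(n)q^n=\frac{1}{(q;q)_\infty}\sum_{n\geq0}(-1)^nq^{\frac{An(n-1)}{2}+an}.$$
   Context: $(q;q)_\infty=\prod_{k\ge1}(1-q^k)$. A partition of $n$ is a finite multiset of positive integers summing to $n$. For positive integers $A,a$ and a partition $\pi$, $\mathrm{mex}_{A,a}(\pi)$ is the smallest element of $\{a,a+A,a+2A,\dots\}$ that is not a part of $\pi$. $p_{A,a}(n)$ is the number of partitions $\pi$ of $n$ with $\mathrm{mex}_{A,a}(\pi)\equiv a \pmod{2A}$ (so $p_{A,a}(0)=1$). -}

module Defs where

open import Data.Nat using (ℕ; zero; suc; _+_; _*_; _∸_; _≡ᵇ_; _≤ᵇ_; _/_; _%_)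
open import Data.Bool using (Bool; true; false; _∧_; not; if_then_else_)
open import Data.List using (List; []; _∷_; map; concatMap; upTo; filterᵇ; length; sum)
open import Data.Integer as ℤ using (ℤ)

-- A partition π of n is encoded by the list [m₁, …, mₙ] of length n,
-- where mⱼ = number of times the part j occurs in π (every part of a
-- partition of n is ≤ n, and every multiplicity is ≤ n).

lists : ℕ → ℕ → List (List ℕ)
lists zero    b = [] ∷ []
lists (suc l) b = concatMap (λ x → map (x ∷_) (lists l b)) (upTo (suc b))

weightFrom : ℕ → List ℕ → ℕ
weightFrom k []       = 0
weightFrom k (x ∷ xs) = k * x + weightFrom (suc k) xs

mult : List ℕ → ℕ → ℕ
mult []       _             = 0
mult (x ∷ xs) zero          = 0
mult (x ∷ xs) (suc zero)    = x
mult (x ∷ xs) (suc (suc j)) = mult xs (suc j)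

isPart : List ℕ → ℕ → Bool
isPart m j = not (mult m j ≡ᵇ 0)

mexIdxFrom : ℕ → ℕ → List ℕ → ℕ → ℕ → ℕ
mexIdxFrom A a m zero       k = k
mexIdxFrom A a m (suc fuel) k =
  if isPart m (a + k * A) then mexIdxFrom A a m fuel (suc k) else k

-- For a partition of n (encoded by m), mex_{A,a}(π) = a + (mexIdx A a n m) * A.
-- Fuel n+1 suffices since a + n*A > n is never a part when A,a ≥ 1.
mexIdx : ℕ → ℕ → ℕ → List ℕ → ℕ
mexIdx A a n m = mexIdxFrom A a m (suc n) 0

even? : ℕ → Bool
even? k = k % 2 ≡ᵇ 0

-- mex_{A,a}(π) ≡ a (mod 2A)  iff  mex = a + kA with k even
-- p_{A,a}(n)
p : ℕ → ℕ → ℕ → ℕ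
p A a n = length (filterᵇ (λ m → (weightFrom 1 m ≡ᵇ n) ∧ even? (mexIdx A a n m)) (lists n n))

Series : Set
Series = ℕ → ℤ

_⊛_ : Series → Series → Series
(f ⊛ g) N = sum' (upTo (suc N))
  where
  sum' : List ℕ → ℤ
  sum' []       = ℤ.0ℤ
  sum' (i ∷ is) = f i ℤ.* g (N ∸ i) ℤ.+ sum' is

-- coefficients of the finite product ∏_{k=1}^{M} (1 - q^k)
finPoch : ℕ → Series
finPoch zero    N = if N ≡ᵇ 0 then ℤ.1ℤ else ℤ.0ℤ
finPoch (suc M) N =
  finPoch M N ℤ.- (if suc M ≤ᵇ N then finPoch M (N ∸ suc M) else ℤ.0ℤ)

-- (q;q)_∞ = ∏_{k≥1}(1-q^k): its q^N coefficient equals that of ∏_{k=1}^{N}(1-q^k)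
qPochInf : Series
qPochInf N = finPoch N N

pSeries : ℕ → ℕ → Series
pSeries A a n = ℤ.+ (p A a n)

sign : ℕ → ℤ
sign n = if even? n then ℤ.1ℤ else ℤ.-1ℤ

expo : ℕ → ℕ → ℕ → ℕ
expo A a n = A * ((n * (n ∸ 1)) / 2) + a * n

-- Σ_{n≥0} (-1)^n q^{A n(n-1)/2 + a n}; for a ≥ 1 only n ≤ N can contribute to q^N
thetaSeries : ℕ → ℕ → Series
thetaSeries A a N = go (upTo (suc N))
  where
  go : List ℕ → ℤ
  go []       = ℤ.0ℤ
  go (n ∷ ns) = (if expo A a n ≡ᵇ N then sign n else ℤ.0ℤ) ℤ.+ go ns

-- Let e_K = a + (a + A) + ⋯ + (a + (K-1)A) = A K(K-1)/2 + aK. The mex of a partition is at least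
-- a + KA exactly when the parts a, a + A, …, a + (K-1)A all occur, and deleting one copy of each is a
-- bijection onto the partitions of n - e_K. Since [t even] = Σ_{K ≤ t} (-1)^K, this gives
-- p_{A,a}(n) = Σ_K (-1)^K p(n - e_K), so the left-hand side is (q;q)_∞ · Σ p(n)qⁿ · Σ_K (-1)^K q^{e_K},
-- and Euler's identity (q;q)_∞ · Σ p(n)qⁿ = 1 finishes the proof. Partitions are counted through their
-- multiplicity lists, recursively in the smallest part; this makes Euler's identity a telescoping product,
-- as (1 - q^k) times the series of partitions into parts ≥ k is the series of partitions into parts > k.

module Submission where

open import Defs
open import Data.Nat using (ℕ; _≤_)
open import Relation.Binary.PropositionalEquality using (_≡_)

open import Algebra.Bundles using (CommutativeSemigroup)
open import Algebra.Core using (Op₂)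
open import Algebra.Structures using (IsCommutativeMonoid)
open import Data.Bool using (Bool; true; false; if_then_else_)
import Data.Nat as ℕ
open import Data.Nat using (zero; suc; _<_; _∸_; _≤ᵇ_; z≤n; s≤s; z<s; s<s; NonZero; >-nonZero⁻¹)
import Data.Nat.Properties
open import Data.Nat.Properties using (≤ᵇ-reflects-≤; <⇒≱; m≤n⇒m<n∨m≡n; ≤-trans; ≤-pred; m∸n≤m)
open import Data.Empty using (⊥-elim)
open import Data.Sum using (inj₁; inj₂)
open import Function using (_∘_)
open import Relation.Binary.PropositionalEquality using (refl; sym; trans; cong; cong₂; subst; module ≡-Reasoning)
open import Relation.Nullary.Reflects using (ofʸ; ofⁿ)

≤ᵇ-true : ∀ {m n} → m ≤ n → (m ≤ᵇ n) ≡ true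
≤ᵇ-true {m} {n} m≤n with m ≤ᵇ n | ≤ᵇ-reflects-≤ m n
... | true  | _       = refl
... | false | ofⁿ m≰n = ⊥-elim (m≰n m≤n)

≤ᵇ-false : ∀ {m n} → n < m → (m ≤ᵇ n) ≡ false
≤ᵇ-false {m} {n} n<m with m ≤ᵇ n | ≤ᵇ-reflects-≤ m n
... | true  | ofʸ m≤n = ⊥-elim (<⇒≱ n<m m≤n)
... | false | _       = refl

eventually-constant : {X : Set} (f : ℕ → X) {m : ℕ} → (∀ M → m ≤ M → f (suc M) ≡ f M) →
                      ∀ {M} → m ≤ M → f M ≡ f m
eventually-constant f step {M = zero}  z≤n = refl
eventually-constant f step {M = suc M} m≤1+M with m≤n⇒m<n∨m≡n m≤1+M
... | inj₁ (s≤s m≤M) = trans (step M m≤M) (eventually-constant f step m≤M)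
... | inj₂ refl      = refl

module Sums {A : Set} {_∙_ : Op₂ A} {ε : A} (isCommutativeMonoid : IsCommutativeMonoid _≡_ _∙_ ε) where

  open IsCommutativeMonoid isCommutativeMonoid using (identityˡ; identityʳ; assoc; comm; isCommutativeSemigroup)

  commutativeSemigroup : CommutativeSemigroup _ _
  commutativeSemigroup = record { isCommutativeSemigroup = isCommutativeSemigroup }

  open import Algebra.Properties.CommutativeSemigroup commutativeSemigroup using (interchange)

  open import Data.Nat using (_+_; _*_)
  open import Data.Nat.Properties
    using (≤-total; <-≤-trans; ≰⇒>; ∸-+-assoc; m≤o∸n⇒m+n≤o; m+n≤o⇒m≤o∸n; m≤m+n; m≤n*m;
           +-comm; +-monoʳ-≤; +-monoʳ-<; *-monoʳ-≤; m+[n∸m]≡n; module ≤-Reasoning)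

  ∑ : ℕ → (ℕ → A) → A
  ∑ zero    f = ε
  ∑ (suc n) f = f 0 ∙ ∑ n (f ∘ suc)

  ∑-cong : ∀ n {f g : ℕ → A} → (∀ i → i < n → f i ≡ g i) → ∑ n f ≡ ∑ n g
  ∑-cong zero    eq = refl
  ∑-cong (suc n) eq = cong₂ _∙_ (eq 0 z<s) (∑-cong n (λ i i<n → eq (suc i) (s<s i<n)))

  ∑-zero : ∀ n {f : ℕ → A} → (∀ i → i < n → f i ≡ ε) → ∑ n f ≡ ε
  ∑-zero zero    eq = refl
  ∑-zero (suc n) eq =
    trans (cong₂ _∙_ (eq 0 z<s) (∑-zero n (λ i i<n → eq (suc i) (s<s i<n)))) (identityˡ ε)

  ∑-truncate : ∀ {m n} {f : ℕ → A} → m ≤ n → (∀ i → m ≤ i → i < n → f i ≡ ε) →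
               ∑ n f ≡ ∑ m f
  ∑-truncate {zero}  {n}             _         vanish = ∑-zero n (λ i → vanish i z≤n)
  ∑-truncate {suc m} {suc n} {f} (s≤s m≤n) vanish =
    cong (f 0 ∙_) (∑-truncate m≤n (λ i m≤i i<n → vanish (suc i) (s≤s m≤i) (s<s i<n)))

  ∑-bound-irrelevant : ∀ m n {f : ℕ → A} →
                       (∀ i → m ≤ i → f i ≡ ε) → (∀ i → n ≤ i → f i ≡ ε) → ∑ m f ≡ ∑ n f
  ∑-bound-irrelevant m n vanishₘ vanishₙ with ≤-total m n
  ... | inj₁ m≤n = sym (∑-truncate m≤n (λ i m≤i _ → vanishₘ i m≤i))
  ... | inj₂ n≤m = ∑-truncate n≤m (λ i n≤i _ → vanishₙ i n≤i)

  ∑-∙ : ∀ n (f g : ℕ → A) → ∑ n (λ i → f i ∙ g i) ≡ ∑ n f ∙ ∑ n g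
  ∑-∙ zero    f g = sym (identityˡ ε)
  ∑-∙ (suc n) f g =
    trans (cong ((f 0 ∙ g 0) ∙_) (∑-∙ n (f ∘ suc) (g ∘ suc))) (interchange (f 0) (g 0) _ _)

  ∑-hom : (h : A → A) → h ε ≡ ε → (∀ x y → h (x ∙ y) ≡ h x ∙ h y) →
          ∀ n (f : ℕ → A) → h (∑ n f) ≡ ∑ n (h ∘ f)
  ∑-hom h h-ε h-∙ zero    f = h-ε
  ∑-hom h h-ε h-∙ (suc n) f = trans (h-∙ (f 0) _) (cong (h (f 0) ∙_) (∑-hom h h-ε h-∙ n (f ∘ suc)))

  ∑-swap : ∀ m n (f : ℕ → ℕ → A) → ∑ m (λ i → ∑ n (f i)) ≡ ∑ n (λ j → ∑ m (λ i → f i j))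
  ∑-swap zero    n f = sym (∑-zero n (λ _ _ → refl))
  ∑-swap (suc m) n f = trans (cong (∑ n (f 0) ∙_) (∑-swap m n (f ∘ suc)))
                             (sym (∑-∙ n (f 0) (λ j → ∑ m (λ i → f (suc i) j))))

  ∑-snoc : ∀ n (f : ℕ → A) → ∑ (suc n) f ≡ ∑ n f ∙ f n
  ∑-snoc zero    f = trans (identityʳ (f 0)) (sym (identityˡ (f 0)))
  ∑-snoc (suc n) f = trans (cong (f 0 ∙_) (∑-snoc n (f ∘ suc))) (sym (assoc (f 0) _ _))

  ∑-reverse : ∀ n (f : ℕ → A) → ∑ n f ≡ ∑ n (λ i → f (n ∸ suc i))
  ∑-reverse zero    f = refl
  ∑-reverse (suc n) f = begin
    ∑ (suc n) f                             ≡⟨ ∑-snoc n f ⟩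
    ∑ n f ∙ f n                             ≡⟨ cong (_∙ f n) (∑-reverse n f) ⟩
    ∑ n (λ i → f (n ∸ suc i)) ∙ f n         ≡⟨ comm _ (f n) ⟩
    ∑ (suc n) (λ i → f (suc n ∸ suc i))     ∎
    where open ≡-Reasoning

  shift : ℕ → (ℕ → A) → ℕ → A
  shift e f n = if e ≤ᵇ n then f (n ∸ e) else ε

  shift-≤ : ∀ {e n} (f : ℕ → A) → e ≤ n → shift e f n ≡ f (n ∸ e)
  shift-≤ {e} {n} f e≤n = cong (λ c → if c then f (n ∸ e) else ε) (≤ᵇ-true e≤n)

  shift-> : ∀ {e n} (f : ℕ → A) → n < e → shift e f n ≡ ε
  shift-> {e} {n} f n<e = cong (λ c → if c then f (n ∸ e) else ε) (≤ᵇ-false n<e)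

  shift-suc : ∀ k (f : ℕ → A) n → shift (suc k) f (suc n) ≡ shift k f n
  shift-suc zero    f n = refl
  shift-suc (suc k) f n = refl

  shift-cong : ∀ e {n} {f g : ℕ → A} → (∀ i → i ≤ n → f i ≡ g i) → shift e f n ≡ shift e g n
  shift-cong e {n} eq with e ≤ᵇ n
  ... | true  = eq (n ∸ e) (m∸n≤m n e)
  ... | false = refl

  shift-shift : ∀ u v (f : ℕ → A) n → shift u (shift v f) n ≡ shift (u + v) f n
  shift-shift u v f n with u ≤ᵇ n | ≤ᵇ-reflects-≤ u n
  ... | false | ofⁿ u≰n = sym (shift-> f (≰⇒> (λ u+v≤n → u≰n (≤-trans (m≤m+n u v) u+v≤n))))
  ... | true  | ofʸ u≤n with v ≤ᵇ n ∸ u | ≤ᵇ-reflects-≤ v (n ∸ u)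
  ...   | true  | ofʸ v≤n∸u =
    trans (cong f (∸-+-assoc n u v))
          (sym (shift-≤ f (subst (_≤ n) (+-comm v u) (m≤o∸n⇒m+n≤o v u≤n v≤n∸u))))
  ...   | false | ofⁿ v≰n∸u =
    sym (shift-> f (≰⇒> (λ u+v≤n → v≰n∸u (m+n≤o⇒m≤o∸n v (subst (_≤ n) (+-comm u v) u+v≤n)))))

  ∸<⇒<+* : ∀ {k} .{{_ : NonZero k}} {c n x} → c ≤ n → n ∸ c < x → n < c + k * x
  ∸<⇒<+* {k} {c} {n} {x} c≤n n∸c<x = begin-strict
    n             ≡⟨ m+[n∸m]≡n c≤n ⟨
    c + (n ∸ c)   <⟨ +-monoʳ-< c n∸c<x ⟩
    c + x         ≤⟨ +-monoʳ-≤ c (m≤n*m x k) ⟩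
    c + k * x     ∎
    where open ≤-Reasoning

  ∑-shifts : ∀ {k} .{{_ : NonZero k}} c B (f : ℕ → A) n → n < c + k * B →
             ∑ B (λ x → shift (c + k * x) f n)
               ≡ shift c (λ n′ → ∑ (suc n′) (λ x → shift (k * x) f n′)) n
  ∑-shifts {k} c B f n n<c+kB with c ≤ᵇ n | ≤ᵇ-reflects-≤ c n
  ... | false | ofⁿ c≰n = ∑-zero B (λ x _ → shift-> f (<-≤-trans (≰⇒> c≰n) (m≤m+n c (k * x))))
  ... | true  | ofʸ c≤n = begin
    ∑ B (λ x → shift (c + k * x) f n)
      ≡⟨ ∑-bound-irrelevant B (suc (n ∸ c)) beyond-B beyond-n∸c ⟩
    ∑ (suc (n ∸ c)) (λ x → shift (c + k * x) f n)
      ≡⟨ ∑-cong (suc (n ∸ c)) (λ x _ → trans (sym (shift-shift c (k * x) f n))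
                                             (shift-≤ (shift (k * x) f) c≤n)) ⟩
    ∑ (suc (n ∸ c)) (λ x → shift (k * x) f (n ∸ c)) ∎
    where
    open ≡-Reasoning
    beyond-B : ∀ x → B ≤ x → shift (c + k * x) f n ≡ ε
    beyond-B x B≤x = shift-> f (<-≤-trans n<c+kB (+-monoʳ-≤ c (*-monoʳ-≤ k B≤x)))
    beyond-n∸c : ∀ x → suc (n ∸ c) ≤ x → shift (c + k * x) f n ≡ ε
    beyond-n∸c x n∸c<x = shift-> f (∸<⇒<+* c≤n n∸c<x)

module ℕSums = Sums Data.Nat.Properties.+-0-isCommutativeMonoid

module Partitions where

  open ℕSums

  open import Data.Bool using (_∧_; _∨_; not)
  open import Data.Bool.Properties using (∧-zeroʳ)
  open import Data.List using (List; []; _∷_; _++_; map; concatMap; applyUpTo; filterᵇ; length)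
  open import Data.Nat using (_+_; _*_; _≡ᵇ_; _/_)
  open import Data.Nat.Properties
    using (+-identityʳ; +-suc; +-comm; *-suc; *-zeroʳ; ≡ᵇ⇒≡; ≡⇒≡ᵇ; n≤1+n; m≤m+n; m≤n+m; m<m+n; m<n+m;
           m≤n*m; m+[n∸m]≡n; <-≤-trans; ≤-<-trans; ≤-<-connex; ≤-refl)
  open import Data.Nat.DivMod using (+-distrib-/-∣ʳ; m*n/n≡m)
  open import Data.Nat.Divisibility using (divides-refl)
  open import Data.Nat.Tactic.RingSolver using (solve-∀)
  open import Relation.Nullary.Reflects using (Reflects; fromEquivalence)

  ≡ᵇ-reflects-≡ : ∀ m n → Reflects (m ≡ n) (m ≡ᵇ n)
  ≡ᵇ-reflects-≡ m n = fromEquivalence (≡ᵇ⇒≡ m n) (≡⇒≡ᵇ m n)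

  +-≡ᵇ-cancelˡ : ∀ u w n → (u + w ≡ᵇ u + n) ≡ (w ≡ᵇ n)
  +-≡ᵇ-cancelˡ zero    w n = refl
  +-≡ᵇ-cancelˡ (suc u) w n = +-≡ᵇ-cancelˡ u w n

  ≤-<-suc-+ : ∀ {i n k L} → i ≤ n → n < k + suc L → i < suc k + L
  ≤-<-suc-+ {n = n} {k} {L} i≤n n<k+1+L = ≤-<-trans i≤n (subst (n <_) (+-suc k L) n<k+1+L)

  count : {X : Set} → (X → Bool) → List X → ℕ
  count P xs = length (filterᵇ P xs)

  count-cong : {X : Set} {P Q : X → Bool} (xs : List X) → (∀ x → P x ≡ Q x) → count P xs ≡ count Q xs
  count-cong []       eq = refl
  count-cong {P = P} {Q} (x ∷ xs) eq with P x | Q x | eq x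
  ... | true  | true  | _ = cong suc (count-cong xs eq)
  ... | false | false | _ = count-cong xs eq

  count-singleton : {X : Set} (P : X → Bool) (x : X) → count P (x ∷ []) ≡ (if P x then 1 else 0)
  count-singleton P x with P x
  ... | true  = refl
  ... | false = refl

  count-∷ : {X : Set} (P : X → Bool) (x : X) (xs : List X) →
            count P (x ∷ xs) ≡ (if P x then 1 else 0) + count P xs
  count-∷ P x xs with P x
  ... | true  = refl
  ... | false = refl

  count-false : {X : Set} (xs : List X) → count (λ _ → false) xs ≡ 0
  count-false []       = refl
  count-false (x ∷ xs) = count-false xs

  count-++ : {X : Set} (P : X → Bool) (xs ys : List X) → count P (xs ++ ys) ≡ count P xs + count P ys
  count-++ P []       ys = refl
  count-++ P (x ∷ xs) ys with P x
  ... | true  = cong suc (count-++ P xs ys)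
  ... | false = count-++ P xs ys

  count-map : {X Y : Set} (P : Y → Bool) (h : X → Y) (xs : List X) → count P (map h xs) ≡ count (P ∘ h) xs
  count-map P h []       = refl
  count-map P h (x ∷ xs) with P (h x)
  ... | true  = cong suc (count-map P h xs)
  ... | false = count-map P h xs

  count-concatMap : {X Y : Set} (P : Y → Bool) (h : X → List Y) (F : ℕ → X) (n : ℕ) →
                    count P (concatMap h (applyUpTo F n)) ≡ ∑ n (λ x → count P (h (F x)))
  count-concatMap P h F zero    = refl
  count-concatMap P h F (suc n) =
    trans (count-++ P (h (F 0)) _) (cong (count P (h (F 0)) +_) (count-concatMap P h (F ∘ suc) n))

  count-lists : (P : List ℕ → Bool) (L b : ℕ) →
                count P (lists (suc L) b) ≡ ∑ (suc b) (λ x → count (P ∘ (x ∷_)) (lists L b))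
  count-lists P L b =
    trans (count-concatMap P (λ x → map (x ∷_) (lists L b)) (λ x → x) (suc b))
          (∑-cong (suc b) (λ x _ → count-map P (x ∷_) (lists L b)))

  count-weight-shift : {X : Set} (u : ℕ) (w : X → ℕ) (Q : X → Bool) (n : ℕ) (xs : List X) →
    count (λ m → (u + w m ≡ᵇ n) ∧ Q m) xs ≡ shift u (λ n′ → count (λ m → (w m ≡ᵇ n′) ∧ Q m) xs) n
  count-weight-shift u w Q n xs with u ≤ᵇ n | ≤ᵇ-reflects-≤ u n
  ... | true  | ofʸ u≤n = count-cong xs (λ m →
          cong (_∧ Q m) (trans (cong (u + w m ≡ᵇ_) (sym (m+[n∸m]≡n u≤n)))
                               (+-≡ᵇ-cancelˡ u (w m) (n ∸ u))))
  ... | false | ofⁿ u≰n = trans (count-cong xs (λ m → cong (_∧ Q m) (u+w≢n m))) (count-false xs)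
    where
    u+w≢n : ∀ m → (u + w m ≡ᵇ n) ≡ false
    u+w≢n m with u + w m ≡ᵇ n | ≡ᵇ-reflects-≡ (u + w m) n
    ... | true  | ofʸ u+w≡n = ⊥-elim (u≰n (subst (u ≤_) u+w≡n (m≤m+n u (w m))))
    ... | false | _         = refl

  -- parts L k n counts the partitions of n into parts from {k, …, k + L - 1}; x is the multiplicity of k.
  parts : ℕ → ℕ → ℕ → ℕ
  parts zero    k n = if n ≡ᵇ 0 then 1 else 0
  parts (suc L) k n = ∑ (suc n) (λ x → shift (k * x) (parts L (suc k)) n)

  parts-rec : ∀ L {k} .{{_ : NonZero k}} n → parts (suc L) k n ≡ parts L (suc k) n + shift k (parts (suc L) k) n
  parts-rec L {k} n = cong₂ _+_
    (cong (λ e → shift e (parts L (suc k)) n) (*-zeroʳ k))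
    (trans (∑-cong n (λ y _ → cong (λ e → shift e (parts L (suc k)) n) (*-suc k y)))
           (∑-shifts k n (parts L (suc k)) n (≤-<-trans (m≤n*m n k) (m<n+m (k * n) (>-nonZero⁻¹ k)))))

  parts-stable : ∀ L {k} .{{_ : NonZero k}} n → n < k + L → parts (suc L) k n ≡ parts L k n
  parts-stable zero    {k} n n<k+0 =
    trans (parts-rec 0 n)
          (trans (cong (parts 0 (suc k) n +_) (shift-> (parts 1 k) (subst (n <_) (+-identityʳ k) n<k+0)))
                 (+-identityʳ (parts 0 k n)))
  parts-stable (suc L) {k} n n<k+1+L = ∑-cong (suc n) (λ x _ → shift-cong (k * x) (λ i i≤n →
    parts-stable L i (≤-<-suc-+ i≤n n<k+1+L)))

  parts-eventually-constant : ∀ {n L} → n ≤ L → parts L 1 n ≡ parts n 1 n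
  parts-eventually-constant {n} =
    eventually-constant (λ L → parts L 1 n) (λ L n≤L → parts-stable L n (s≤s n≤L))

  covers : List Bool → List ℕ → Bool
  covers []       _        = true
  covers (r ∷ rs) []       = not r ∧ covers rs []
  covers (r ∷ rs) (x ∷ xs) = (not r ∨ not (x ≡ᵇ 0)) ∧ covers rs xs

  maskWeight : ℕ → List Bool → ℕ
  maskWeight k []       = 0
  maskWeight k (r ∷ rs) = (if r then k else 0) + maskWeight (suc k) rs

  countCovering : (L b k : ℕ) → List Bool → ℕ → ℕ
  countCovering L b k r n = count (λ m → (weightFrom k m ≡ᵇ n) ∧ covers r m) (lists L b)

  indicator-covers-[] : ∀ {k} r n → n < k →
    (if (0 ≡ᵇ n) ∧ covers r [] then 1 else 0) ≡ shift (maskWeight k r) (parts 0 k) n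
  indicator-covers-[]     []          zero    _   = refl
  indicator-covers-[]     []          (suc n) _   = refl
  indicator-covers-[] {k} (false ∷ r) n       n<k = indicator-covers-[] {suc k} r n (≤-trans n<k (n≤1+n k))
  indicator-covers-[] {k} (true ∷ r)  n       n<k =
    trans (cong (λ c → if c then 1 else 0) (∧-zeroʳ (0 ≡ᵇ n)))
          (sym (shift-> (parts 0 k) (<-≤-trans n<k (m≤m+n k (maskWeight (suc k) r)))))

  countCovering-∷ : ∀ L b {k} .{{_ : NonZero k}} h t n → n ≤ b →
    (∀ n′ → n′ ≤ n →
       countCovering L b (suc k) t n′ ≡ shift (maskWeight (suc k) t) (parts L (suc k)) n′) →
    countCovering (suc L) b k (h ∷ t) n ≡ shift (maskWeight k (h ∷ t)) (parts (suc L) k) n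
  countCovering-∷ L b {k} h t n n≤b ih = trans (count-lists _ L b) (by-head h)
    where
    w = maskWeight (suc k) t
    P = parts L (suc k)
    term : ∀ x → count (λ m → (k * x + weightFrom (suc k) m ≡ᵇ n) ∧ covers t m) (lists L b)
                   ≡ shift (k * x + w) P n
    term x = trans (count-weight-shift (k * x) (weightFrom (suc k)) (covers t) n (lists L b))
                   (trans (shift-cong (k * x) ih) (shift-shift (k * x) w P n))
    absent : count (λ m → (k * 0 + weightFrom (suc k) m ≡ᵇ n) ∧ false) (lists L b) ≡ 0
    absent = trans (count-cong (lists L b) (λ m → ∧-zeroʳ _)) (count-false (lists L b))
    regroup : ∀ k y w → k * suc y + w ≡ k + w + k * y
    regroup = solve-∀
    by-head : ∀ h →
      ∑ (suc b) (λ x → count (λ m → (weightFrom k (x ∷ m) ≡ᵇ n) ∧ covers (h ∷ t) (x ∷ m)) (lists L b))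
        ≡ shift (maskWeight k (h ∷ t)) (parts (suc L) k) n
    by-head false =
      trans (∑-cong (suc b) (λ x _ → trans (term x) (cong (λ e → shift e P n) (+-comm (k * x) w))))
            (∑-shifts w (suc b) P n
              (<-≤-trans (s≤s n≤b) (≤-trans (m≤n*m (suc b) k) (m≤n+m (k * suc b) w))))
    by-head true =
      trans (cong₂ _+_ absent
                  (∑-cong b (λ y _ → trans (term (suc y)) (cong (λ e → shift e P n) (regroup k y w)))))
            (∑-shifts (k + w) b P n (≤-<-trans (≤-trans n≤b (m≤n*m b k))
                                                (m<n+m (k * b) (≤-trans (>-nonZero⁻¹ k) (m≤m+n k w)))))

  covers-[] : ∀ m → covers [] m ≡ covers (false ∷ []) m
  covers-[] []      = refl
  covers-[] (_ ∷ _) = refl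

  countCovering≡shift : ∀ L b {k} .{{_ : NonZero k}} r n → n < k + L → n ≤ b →
                        countCovering L b k r n ≡ shift (maskWeight k r) (parts L k) n
  countCovering≡shift zero    b {k} r n n<k+0 _ =
    trans (count-singleton (λ m → (weightFrom k m ≡ᵇ n) ∧ covers r m) [])
          (indicator-covers-[] r n (subst (n <_) (+-identityʳ k) n<k+0))
  countCovering≡shift (suc L) b {k} [] n n<k+1+L n≤b =
    trans (count-cong (lists (suc L) b) (λ m → cong ((weightFrom k m ≡ᵇ n) ∧_) (covers-[] m)))
          (countCovering-∷ L b false [] n n≤b
            (λ n′ n′≤n → countCovering≡shift L b [] n′ (≤-<-suc-+ n′≤n n<k+1+L) (≤-trans n′≤n n≤b)))
  countCovering≡shift (suc L) b (h ∷ t) n n<k+1+L n≤b =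
    countCovering-∷ L b h t n n≤b
      (λ n′ n′≤n → countCovering≡shift L b t n′ (≤-<-suc-+ n′≤n n<k+1+L) (≤-trans n′≤n n≤b))

  hasProgression : List ℕ → ℕ → ℕ → ℕ → Bool
  hasProgression m r A zero    = true
  hasProgression m r A (suc K) = isPart m r ∧ hasProgression m (r + A) A K

  mexIdxFrom-≥-start : ∀ A a m fuel k → k ≤ mexIdxFrom A a m fuel k
  mexIdxFrom-≥-start A a m zero       k = ≤-refl
  mexIdxFrom-≥-start A a m (suc fuel) k with isPart m (a + k * A)
  ... | true  = ≤-trans (n≤1+n k) (mexIdxFrom-≥-start A a m fuel (suc k))
  ... | false = ≤-refl

  mexIdxFrom-≤ : ∀ A a m fuel k → mexIdxFrom A a m fuel k ≤ k + fuel
  mexIdxFrom-≤ A a m zero       k = m≤m+n k 0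
  mexIdxFrom-≤ A a m (suc fuel) k with isPart m (a + k * A)
  ... | true  = subst (mexIdxFrom A a m fuel (suc k) ≤_) (sym (+-suc k fuel)) (mexIdxFrom-≤ A a m fuel (suc k))
  ... | false = m≤m+n k (suc fuel)

  mexIdxFrom-≥ : ∀ A a m fuel k K → K ≤ fuel →
                 (k + K ≤ᵇ mexIdxFrom A a m fuel k) ≡ hasProgression m (a + k * A) A K
  mexIdxFrom-≥ A a m fuel k zero _ =
    ≤ᵇ-true (subst (_≤ mexIdxFrom A a m fuel k) (sym (+-identityʳ k)) (mexIdxFrom-≥-start A a m fuel k))
  mexIdxFrom-≥ A a m (suc fuel) k (suc K) (s≤s K≤fuel) with isPart m (a + k * A)
  ... | true  = trans (cong (_≤ᵇ mexIdxFrom A a m fuel (suc k)) (+-suc k K))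
                      (trans (mexIdxFrom-≥ A a m fuel (suc k) K K≤fuel)
                             (cong (λ r → hasProgression m r A K) (next a k A)))
    where next : ∀ a k A → a + suc k * A ≡ a + k * A + A
          next = solve-∀
  ... | false = ≤ᵇ-false (m<m+n k z<s)

  mexIdx-≥ : ∀ A a n m K → K ≤ suc n → (K ≤ᵇ mexIdx A a n m) ≡ hasProgression m a A K
  mexIdx-≥ A a n m K K≤1+n =
    trans (mexIdxFrom-≥ A a m (suc n) 0 K K≤1+n) (cong (λ r → hasProgression m r A K) (+-identityʳ a))

  mexIdx-≤ : ∀ A a n m → mexIdx A a n m ≤ suc n
  mexIdx-≤ A a n m = mexIdxFrom-≤ A a m (suc n) 0

  -- apMask d g K marks the positions d, d + (g + 1), …, d + (K - 1)(g + 1).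
  apMask : ℕ → ℕ → ℕ → List Bool
  apMask d       g zero    = []
  apMask zero    g (suc K) = true ∷ apMask g g K
  apMask (suc d) g (suc K) = false ∷ apMask d g (suc K)

  hasProgression-∷ : ∀ x xs j A K → hasProgression (x ∷ xs) (suc (suc j)) A K ≡ hasProgression xs (suc j) A K
  hasProgression-∷ x xs j A zero    = refl
  hasProgression-∷ x xs j A (suc K) = cong (isPart xs (suc j) ∧_) (hasProgression-∷ x xs (j + A) A K)

  hasProgression≡covers : ∀ m d g K → hasProgression m (suc d) (suc g) K ≡ covers (apMask d g K) m
  hasProgression≡covers m        d       g zero    = refl
  hasProgression≡covers []       zero    g (suc K) = refl
  hasProgression≡covers []       (suc d) g (suc K) = hasProgression≡covers [] d g (suc K)
  hasProgression≡covers (x ∷ xs) zero    g (suc K) =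
    cong (not (x ≡ᵇ 0) ∧_) (trans (hasProgression-∷ x xs g (suc g) K) (hasProgression≡covers xs g g K))
  hasProgression≡covers (x ∷ xs) (suc d) g (suc K) =
    trans (hasProgression-∷ x xs d (suc g) (suc K)) (hasProgression≡covers xs d g (suc K))

  triangle-suc : ∀ K → (suc K * K) / 2 ≡ K + (K * (K ∸ 1)) / 2
  triangle-suc zero    = refl
  triangle-suc (suc K) = begin
    (suc (suc K) * suc K) / 2          ≡⟨ cong (_/ 2) (square K) ⟩
    (suc K * K + suc K * 2) / 2        ≡⟨ +-distrib-/-∣ʳ (suc K * K) (divides-refl (suc K)) ⟩
    (suc K * K) / 2 + (suc K * 2) / 2  ≡⟨ cong ((suc K * K) / 2 +_) (m*n/n≡m (suc K) 2) ⟩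
    (suc K * K) / 2 + suc K            ≡⟨ +-comm _ (suc K) ⟩
    suc K + (suc K * K) / 2            ∎
    where
    open ≡-Reasoning
    square : ∀ K → suc (suc K) * suc K ≡ suc K * K + suc K * 2
    square = solve-∀

  expo-zero : ∀ A r → expo A r 0 ≡ 0
  expo-zero A r = cong₂ _+_ (*-zeroʳ A) (*-zeroʳ r)

  expo-suc : ∀ A r K → expo A r (suc K) ≡ r + expo A (r + A) K
  expo-suc A r K = trans (cong (λ T → A * T + r * suc K) (triangle-suc K)) (regroup A r K _)
    where regroup : ∀ A r K T → A * (K + T) + r * suc K ≡ r + (A * T + (r + A) * K)
          regroup = solve-∀

  expo-≥ : ∀ A a .{{_ : NonZero a}} K → K ≤ expo A a K
  expo-≥ A a K = ≤-trans (m≤n*m K a) (m≤n+m (a * K) (A * ((K * (K ∸ 1)) / 2)))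

  maskWeight-apMask : ∀ k d g K → maskWeight k (apMask d g K) ≡ expo (suc g) (k + d) K
  maskWeight-apMask k d       g zero    = sym (expo-zero (suc g) (k + d))
  maskWeight-apMask k zero    g (suc K) = begin
    k + maskWeight (suc k) (apMask g g K)  ≡⟨ cong (k +_) (maskWeight-apMask (suc k) g g K) ⟩
    k + expo (suc g) (suc k + g) K         ≡⟨ cong (λ r → k + expo (suc g) r K) (sym (+-suc k g)) ⟩
    k + expo (suc g) (k + suc g) K         ≡⟨ sym (expo-suc (suc g) k K) ⟩
    expo (suc g) k (suc K)                 ≡⟨ cong (λ r → expo (suc g) r (suc K)) (sym (+-identityʳ k)) ⟩
    expo (suc g) (k + 0) (suc K)           ∎
    where open ≡-Reasoning
  maskWeight-apMask k (suc d) g (suc K) =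
    trans (maskWeight-apMask (suc k) d g (suc K)) (cong (λ r → expo (suc g) r (suc K)) (sym (+-suc k d)))

  partitions : ℕ → ℕ
  partitions r = parts r 1 r

  count-mex-≥ : ∀ d g n K →
    count (λ m → (weightFrom 1 m ≡ᵇ n) ∧ (K ≤ᵇ mexIdx (suc g) (suc d) n m)) (lists n n)
      ≡ shift (expo (suc g) (suc d) K) partitions n
  count-mex-≥ d g n K with ≤-<-connex K (suc n)
  ... | inj₁ K≤1+n = begin
    count (λ m → (weightFrom 1 m ≡ᵇ n) ∧ (K ≤ᵇ mexIdx (suc g) (suc d) n m)) (lists n n)
      ≡⟨ count-cong (lists n n) (λ m → cong ((weightFrom 1 m ≡ᵇ n) ∧_)
           (trans (mexIdx-≥ (suc g) (suc d) n m K K≤1+n) (hasProgression≡covers m d g K))) ⟩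
    count (λ m → (weightFrom 1 m ≡ᵇ n) ∧ covers (apMask d g K) m) (lists n n)
      ≡⟨ countCovering≡shift n n (apMask d g K) n ≤-refl ≤-refl ⟩
    shift (maskWeight 1 (apMask d g K)) (parts n 1) n
      ≡⟨ cong (λ e → shift e (parts n 1) n) (maskWeight-apMask 1 d g K) ⟩
    shift (expo (suc g) (suc d) K) (parts n 1) n
      ≡⟨ shift-cong (expo (suc g) (suc d) K) (λ i i≤n → parts-eventually-constant i≤n) ⟩
    shift (expo (suc g) (suc d) K) partitions n ∎
    where open ≡-Reasoning
  ... | inj₂ 1+n<K =
    trans (count-cong (lists n n) (λ m → trans (cong ((weightFrom 1 m ≡ᵇ n) ∧_)
                                  (≤ᵇ-false (≤-<-trans (mexIdx-≤ (suc g) (suc d) n m) 1+n<K)))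
                           (∧-zeroʳ _)))
          (trans (count-false (lists n n))
                 (sym (shift-> partitions
                        (<-≤-trans (≤-trans (n≤1+n (suc n)) 1+n<K) (expo-≥ (suc g) (suc d) K)))))

module PowerSeries where

  open import Data.Integer using (ℤ; +_; 0ℤ; 1ℤ; _+_; _*_; _-_; -_)
  open import Data.Integer.Properties
    using (+-0-isCommutativeMonoid; +-identityˡ; +-identityʳ; *-identityˡ; *-zeroʳ; *-comm; *-distribˡ-+;
           neg-distrib-+; pos-+)
  open import Data.Integer.Tactic.RingSolver using (solve-∀)
  open import Data.List using (List; []; _∷_; foldr; applyUpTo; upTo)
  open import Data.Nat using (_≡ᵇ_)
  open import Data.Nat.Properties using (m∸[m∸n]≡n; +-suc)
  import Data.Nat.Properties as ℕₚ
  open Sums +-0-isCommutativeMonoid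
  open Partitions using (parts; parts-rec; partitions; parts-eventually-constant)

  conv : Series → Series → Series
  conv f g N = ∑ (suc N) (λ i → f i * g (N ∸ i))

  -- _⊛_ and thetaSeries sum through where-bound folds, which cannot be named; abstracting the list
  -- they fold over lets unification recognise such a fold as the S of fold-unique.
  fold-unique : (F : ℕ → ℤ) (S : List ℕ → ℤ) → S [] ≡ 0ℤ → (∀ x xs → S (x ∷ xs) ≡ F x + S xs) →
                ∀ xs → S xs ≡ foldr (λ x s → F x + s) 0ℤ xs
  fold-unique F S S-[] S-∷ []       = S-[]
  fold-unique F S S-[] S-∷ (x ∷ xs) = trans (S-∷ x xs) (cong (λ s → F x + s) (fold-unique F S S-[] S-∷ xs))

  foldr-applyUpTo : ∀ (F : ℕ → ℤ) h n → foldr (λ x s → F x + s) 0ℤ (applyUpTo h n) ≡ ∑ n (F ∘ h)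
  foldr-applyUpTo F h zero    = refl
  foldr-applyUpTo F h (suc n) = cong (λ s → F (h 0) + s) (foldr-applyUpTo F (h ∘ suc) n)

  ⊛-as-foldr : ∀ f g N → (f ⊛ g) N ≡ foldr (λ i s → f i * g (N ∸ i) + s) 0ℤ (upTo (suc N))
  ⊛-as-foldr f g N with applyUpTo suc N | fold-unique (λ i → f i * g (N ∸ i)) _ refl (λ _ _ → refl)
  ... | xs | fold≡foldr = cong (λ s → f 0 * g N + s) (fold≡foldr xs)

  ⊛-as-conv : ∀ f g N → (f ⊛ g) N ≡ conv f g N
  ⊛-as-conv f g N = trans (⊛-as-foldr f g N) (foldr-applyUpTo (λ i → f i * g (N ∸ i)) (λ i → i) (suc N))

  thetaSeries-as-foldr : ∀ A a N →
    thetaSeries A a N ≡ foldr (λ K s → (if expo A a K ≡ᵇ N then sign K else 0ℤ) + s) 0ℤ (upTo (suc N))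
  thetaSeries-as-foldr A a N
    with applyUpTo suc N | fold-unique (λ K → if expo A a K ≡ᵇ N then sign K else 0ℤ) _ refl (λ _ _ → refl)
  ... | xs | fold≡foldr = cong (λ s → (if expo A a 0 ≡ᵇ N then sign 0 else 0ℤ) + s) (fold≡foldr xs)

  thetaSeries-as-∑ : ∀ A a N → thetaSeries A a N ≡ ∑ (suc N) (λ K → if expo A a K ≡ᵇ N then sign K else 0ℤ)
  thetaSeries-as-∑ A a N = trans (thetaSeries-as-foldr A a N)
    (foldr-applyUpTo (λ K → if expo A a K ≡ᵇ N then sign K else 0ℤ) (λ K → K) (suc N))

  conv-cong : ∀ N {f f′ g g′ : Series} →
              (∀ i → i ≤ N → f i ≡ f′ i) → (∀ i → i ≤ N → g i ≡ g′ i) → conv f g N ≡ conv f′ g′ N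
  conv-cong N f≡f′ g≡g′ =
    ∑-cong (suc N) (λ i i<1+N → cong₂ _*_ (f≡f′ i (≤-pred i<1+N)) (g≡g′ (N ∸ i) (m∸n≤m N i)))

  conv-congʳ : ∀ f N {g h : Series} → (∀ i → i ≤ N → g i ≡ h i) → conv f g N ≡ conv f h N
  conv-congʳ f N = conv-cong N {f} {f} (λ _ _ → refl)

  conv-comm : ∀ f g N → conv f g N ≡ conv g f N
  conv-comm f g N = begin
    ∑ (suc N) (λ i → f i * g (N ∸ i))
      ≡⟨ ∑-reverse (suc N) (λ i → f i * g (N ∸ i)) ⟩
    ∑ (suc N) (λ i → f (N ∸ i) * g (N ∸ (N ∸ i)))
      ≡⟨ ∑-cong (suc N) (λ i i<1+N → trans (cong (λ j → f (N ∸ i) * g j) (m∸[m∸n]≡n (≤-pred i<1+N)))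
                                           (*-comm (f (N ∸ i)) (g i))) ⟩
    ∑ (suc N) (λ i → g i * f (N ∸ i)) ∎
    where open ≡-Reasoning

  conv-shiftˡ : ∀ k f g N → conv (shift k f) g N ≡ shift k (conv f g) N
  conv-shiftˡ zero    f g N       = refl
  conv-shiftˡ (suc k) f g zero    = refl
  conv-shiftˡ (suc k) f g (suc N) = begin
    0ℤ + ∑ (suc N) (λ i → shift (suc k) f (suc i) * g (N ∸ i))
      ≡⟨ +-identityˡ _ ⟩
    ∑ (suc N) (λ i → shift (suc k) f (suc i) * g (N ∸ i))
      ≡⟨ ∑-cong (suc N) (λ i _ → cong (_* g (N ∸ i)) (shift-suc k f i)) ⟩
    conv (shift k f) g N
      ≡⟨ conv-shiftˡ k f g N ⟩
    shift k (conv f g) N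
      ≡⟨ shift-suc k (conv f g) N ⟨
    shift (suc k) (conv f g) (suc N) ∎
    where open ≡-Reasoning

  conv-shiftʳ : ∀ k f g N → conv f (shift k g) N ≡ shift k (conv f g) N
  conv-shiftʳ k f g N =
    trans (conv-comm f (shift k g) N)
          (trans (conv-shiftˡ k g f N) (shift-cong k (λ i _ → conv-comm g f i)))

  conv-∑ʳ : ∀ R (c : ℕ → ℤ) f (g : ℕ → Series) N →
            conv f (λ n → ∑ R (λ K → c K * g K n)) N ≡ ∑ R (λ K → c K * conv f (g K) N)
  conv-∑ʳ R c f g N = begin
    ∑ (suc N) (λ i → f i * ∑ R (λ K → c K * g K (N ∸ i)))
      ≡⟨ ∑-cong (suc N) (λ i _ → ∑-hom (f i *_) (*-zeroʳ (f i)) (*-distribˡ-+ (f i)) R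
                                       (λ K → c K * g K (N ∸ i))) ⟩
    ∑ (suc N) (λ i → ∑ R (λ K → f i * (c K * g K (N ∸ i))))
      ≡⟨ ∑-cong (suc N) (λ i _ → ∑-cong R (λ K _ → swap-factors (f i) (c K) (g K (N ∸ i)))) ⟩
    ∑ (suc N) (λ i → ∑ R (λ K → c K * (f i * g K (N ∸ i))))
      ≡⟨ ∑-swap (suc N) R (λ i K → c K * (f i * g K (N ∸ i))) ⟩
    ∑ R (λ K → ∑ (suc N) (λ i → c K * (f i * g K (N ∸ i))))
      ≡⟨ ∑-cong R (λ K _ → ∑-hom (c K *_) (*-zeroʳ (c K)) (*-distribˡ-+ (c K)) (suc N)
                                 (λ i → f i * g K (N ∸ i))) ⟨
    ∑ R (λ K → c K * conv f (g K) N) ∎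
    where
    open ≡-Reasoning
    swap-factors : ∀ x y z → x * (y * z) ≡ y * (x * z)
    swap-factors = solve-∀

  δ : Series
  δ n = if n ≡ᵇ 0 then 1ℤ else 0ℤ

  shift-δ : ∀ e N → shift e δ N ≡ (if e ≡ᵇ N then 1ℤ else 0ℤ)
  shift-δ zero    zero    = refl
  shift-δ zero    (suc N) = refl
  shift-δ (suc e) zero    = refl
  shift-δ (suc e) (suc N) = trans (shift-suc e δ N) (shift-δ e N)

  1-q^_·_ : ℕ → Series → Series
  (1-q^ k · f) n = f n - shift k f n

  1-q^-cong : ∀ k {f g : Series} → (∀ n → f n ≡ g n) → ∀ n → (1-q^ k · f) n ≡ (1-q^ k · g) n
  1-q^-cong k f≡g n = cong₂ _-_ (f≡g n) (shift-cong k (λ i _ → f≡g i))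

  conv-1-q^ˡ : ∀ k f g N → conv (1-q^ k · f) g N ≡ (1-q^ k · conv f g) N
  conv-1-q^ˡ k f g N = begin
    ∑ (suc N) (λ i → (f i - shift k f i) * g (N ∸ i))
      ≡⟨ ∑-cong (suc N) (λ i _ → distrib (f i) (shift k f i) (g (N ∸ i))) ⟩
    ∑ (suc N) (λ i → f i * g (N ∸ i) + - (shift k f i * g (N ∸ i)))
      ≡⟨ ∑-∙ (suc N) (λ i → f i * g (N ∸ i)) (λ i → - (shift k f i * g (N ∸ i))) ⟩
    conv f g N + ∑ (suc N) (λ i → - (shift k f i * g (N ∸ i)))
      ≡⟨ cong (λ s → conv f g N + s)
              (∑-hom -_ refl neg-distrib-+ (suc N) (λ i → shift k f i * g (N ∸ i))) ⟨
    conv f g N - conv (shift k f) g N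
      ≡⟨ cong (λ s → conv f g N - s) (conv-shiftˡ k f g N) ⟩
    (1-q^ k · conv f g) N ∎
    where
    open ≡-Reasoning
    distrib : ∀ x y z → (x - y) * z ≡ x * z + - (y * z)
    distrib = solve-∀

  conv-δˡ : ∀ g N → conv δ g N ≡ g N
  conv-δˡ g N = trans (cong₂ _+_ (*-identityˡ (g N)) (∑-zero N (λ _ _ → refl))) (+-identityʳ (g N))

  factorsFrom : ℕ → ℕ → Series → Series
  factorsFrom k zero    g = g
  factorsFrom k (suc L) g = factorsFrom (suc k) L (1-q^ k · g)

  factorsFrom-cong : ∀ k L {f g : Series} → (∀ n → f n ≡ g n) →
                     ∀ n → factorsFrom k L f n ≡ factorsFrom k L g n
  factorsFrom-cong k zero    f≡g = f≡g
  factorsFrom-cong k (suc L) f≡g = factorsFrom-cong (suc k) L (1-q^-cong k f≡g)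

  factorsFrom-last : ∀ k L g n → factorsFrom k (suc L) g n ≡ (1-q^ (k ℕ.+ L) · factorsFrom k L g) n
  factorsFrom-last k zero    g n = cong (λ e → (1-q^ e · g) n) (sym (ℕₚ.+-identityʳ k))
  factorsFrom-last k (suc L) g n =
    trans (factorsFrom-last (suc k) L (1-q^ k · g) n)
          (cong (λ e → (1-q^ e · factorsFrom k (suc L) g) n) (sym (+-suc k L)))

  conv-finPoch : ∀ M g N → conv (finPoch M) g N ≡ factorsFrom 1 M g N
  conv-finPoch zero    g N = conv-δˡ g N
  conv-finPoch (suc M) g N =
    trans (conv-1-q^ˡ (suc M) (finPoch M) g N)
          (trans (1-q^-cong (suc M) (conv-finPoch M g) N) (sym (factorsFrom-last 1 M g N)))

  pos-shift : ∀ e (f : ℕ → ℕ) n → + ℕSums.shift e f n ≡ shift e (+_ ∘ f) n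
  pos-shift e f n with e ≤ᵇ n
  ... | true  = refl
  ... | false = refl

  1-q^-parts : ∀ L {k} .{{_ : NonZero k}} n → (1-q^ k · (+_ ∘ parts (suc L) k)) n ≡ + parts L (suc k) n
  1-q^-parts L {k} n = begin
    + parts (suc L) k n - shift k (+_ ∘ parts (suc L) k) n
      ≡⟨ cong₂ _-_ (cong +_ (parts-rec L n)) (sym (pos-shift k (parts (suc L) k) n)) ⟩
    + (parts L (suc k) n ℕ.+ s) - + s
      ≡⟨ cong (_- + s) (pos-+ (parts L (suc k) n) s) ⟩
    + parts L (suc k) n + + s - + s
      ≡⟨ cancel (+ parts L (suc k) n) (+ s) ⟩
    + parts L (suc k) n ∎
    where
    open ≡-Reasoning
    s = ℕSums.shift k (parts (suc L) k) n
    cancel : ∀ x y → x + y - y ≡ x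
    cancel = solve-∀

  factorsFrom-parts : ∀ L k .{{_ : NonZero k}} n → factorsFrom k L (+_ ∘ parts L k) n ≡ δ n
  factorsFrom-parts zero    k zero    = refl
  factorsFrom-parts zero    k (suc n) = refl
  factorsFrom-parts (suc L) k n =
    trans (factorsFrom-cong (suc k) L (1-q^-parts L) n) (factorsFrom-parts L (suc k) n)

  finPoch-eventually-constant : ∀ {n M} → n ≤ M → finPoch M n ≡ finPoch n n
  finPoch-eventually-constant {n} = eventually-constant (λ M → finPoch M n) (λ M n≤M →
    trans (cong (λ s → finPoch M n - s) (shift-> (finPoch M) (s≤s n≤M))) (+-identityʳ (finPoch M n)))

  euler : ∀ N → conv qPochInf (+_ ∘ partitions) N ≡ δ N
  euler N = begin
    conv qPochInf (+_ ∘ partitions) N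
      ≡⟨ conv-cong N (λ i i≤N → sym (finPoch-eventually-constant i≤N))
                     (λ j j≤N → cong +_ (sym (parts-eventually-constant j≤N))) ⟩
    conv (finPoch N) (+_ ∘ parts N 1) N    ≡⟨ conv-finPoch N (+_ ∘ parts N 1) N ⟩
    factorsFrom 1 N (+_ ∘ parts N 1) N     ≡⟨ factorsFrom-parts N 1 N ⟩
    δ N                                    ∎
    where open ≡-Reasoning

module Alternation where

  open import Data.Bool using (_∧_; not)
  open import Data.Integer using (+_; 0ℤ; 1ℤ; -1ℤ; _+_; _*_; _-_; -_)
  open import Data.Integer.Properties
    using (+-0-isCommutativeMonoid; *-identityʳ; *-zeroʳ; *-distribˡ-+; neg-distrib-+; pos-+)
  open import Data.List using (List; []; _∷_)
  open import Data.Nat using (_≡ᵇ_; _%_)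
  open import Data.Nat.DivMod using ([m+n]%n≡m%n)
  open import Data.Nat.Properties using (+-comm; ≤-<-trans; n≤1+n; <-≤-trans)
  open Sums +-0-isCommutativeMonoid
  open Partitions using (count; count-∷; partitions; count-mex-≥; mexIdx-≤; expo-≥)
  open PowerSeries using (δ; pos-shift; shift-δ; thetaSeries-as-∑)

  even?-suc-suc : ∀ n → even? (suc (suc n)) ≡ even? n
  even?-suc-suc n = cong (_≡ᵇ 0) (trans (cong (_% 2) (+-comm 2 n)) ([m+n]%n≡m%n n 2))

  even?-suc : ∀ n → even? (suc n) ≡ not (even? n)
  even?-suc zero          = refl
  even?-suc (suc zero)    = refl
  even?-suc (suc (suc n)) =
    trans (even?-suc-suc (suc n)) (trans (even?-suc n) (cong not (sym (even?-suc-suc n))))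

  sign-suc : ∀ K → sign (suc K) ≡ - sign K
  sign-suc K = trans (cong (λ b → if b then 1ℤ else -1ℤ) (even?-suc K)) (negate (even? K))
    where
    negate : ∀ b → (if not b then 1ℤ else -1ℤ) ≡ - (if b then 1ℤ else -1ℤ)
    negate true  = refl
    negate false = refl

  alternating-sum : ∀ t → ∑ (suc t) sign ≡ (if even? t then 1ℤ else 0ℤ)
  alternating-sum zero    = refl
  alternating-sum (suc t) = begin
    1ℤ + ∑ (suc t) (sign ∘ suc)         ≡⟨ cong (λ s → 1ℤ + s) (∑-cong (suc t) (λ K _ → sign-suc K)) ⟩
    1ℤ + ∑ (suc t) (λ K → - sign K)     ≡⟨ cong (λ s → 1ℤ + s) (∑-hom -_ refl neg-distrib-+ (suc t) sign) ⟨
    1ℤ - ∑ (suc t) sign                 ≡⟨ cong (λ s → 1ℤ - s) (alternating-sum t) ⟩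
    1ℤ - (if even? t then 1ℤ else 0ℤ)   ≡⟨ complement (even? t) ⟩
    (if not (even? t) then 1ℤ else 0ℤ)  ≡⟨ cong (λ b → if b then 1ℤ else 0ℤ) (even?-suc t) ⟨
    (if even? (suc t) then 1ℤ else 0ℤ)  ∎
    where
    open ≡-Reasoning
    complement : ∀ b → 1ℤ - (if b then 1ℤ else 0ℤ) ≡ (if not b then 1ℤ else 0ℤ)
    complement true  = refl
    complement false = refl

  pos-indicator : ∀ b → + (if b then 1 else 0) ≡ (if b then 1ℤ else 0ℤ)
  pos-indicator true  = refl
  pos-indicator false = refl

  *-indicator : ∀ s b → s * (if b then 1ℤ else 0ℤ) ≡ (if b then s else 0ℤ)
  *-indicator s true  = *-identityʳ s
  *-indicator s false = *-zeroʳ s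

  even-indicator : ∀ t R → t < R →
                   (if even? t then 1ℤ else 0ℤ) ≡ ∑ R (λ K → sign K * + (if K ≤ᵇ t then 1 else 0))
  even-indicator t R t<R = sym (begin
    ∑ R (λ K → sign K * + (if K ≤ᵇ t then 1 else 0))
      ≡⟨ ∑-cong R (λ K _ → trans (cong (sign K *_) (pos-indicator (K ≤ᵇ t)))
                                 (*-indicator (sign K) (K ≤ᵇ t))) ⟩
    ∑ R (λ K → if K ≤ᵇ t then sign K else 0ℤ)
      ≡⟨ ∑-truncate t<R (λ K t<K _ → cong (λ b → if b then sign K else 0ℤ) (≤ᵇ-false t<K)) ⟩
    ∑ (suc t) (λ K → if K ≤ᵇ t then sign K else 0ℤ)
      ≡⟨ ∑-cong (suc t) (λ K K<1+t →
           cong (λ b → if b then sign K else 0ℤ) (≤ᵇ-true (≤-pred K<1+t))) ⟩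
    ∑ (suc t) sign
      ≡⟨ alternating-sum t ⟩
    (if even? t then 1ℤ else 0ℤ) ∎)
    where open ≡-Reasoning

  count-even : {X : Set} (P : X → Bool) (t : X → ℕ) (R : ℕ) (xs : List X) → (∀ x → t x < R) →
    + count (λ x → P x ∧ even? (t x)) xs ≡ ∑ R (λ K → sign K * + count (λ x → P x ∧ (K ≤ᵇ t x)) xs)
  count-even P t R []       _    = sym (∑-zero R (λ K _ → *-zeroʳ (sign K)))
  count-even {X} P t R (x ∷ xs) t<R = begin
    + count (λ y → P y ∧ even? (t y)) (x ∷ xs)
      ≡⟨ cong +_ (count-∷ _ x xs) ⟩
    + ((if P x ∧ even? (t x) then 1 else 0) ℕ.+ count (λ y → P y ∧ even? (t y)) xs)
      ≡⟨ pos-+ (if P x ∧ even? (t x) then 1 else 0) (count (λ y → P y ∧ even? (t y)) xs) ⟩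
    + (if P x ∧ even? (t x) then 1 else 0) + + count (λ y → P y ∧ even? (t y)) xs
      ≡⟨ cong₂ _+_ (head-term (P x)) (count-even P t R xs t<R) ⟩
    ∑ R (λ K → sign K * + [ K ]) + ∑ R (λ K → sign K * + count (Q K) xs)
      ≡⟨ ∑-∙ R (λ K → sign K * + [ K ]) (λ K → sign K * + count (Q K) xs) ⟨
    ∑ R (λ K → sign K * + [ K ] + sign K * + count (Q K) xs)
      ≡⟨ ∑-cong R (λ K _ → *-distribˡ-+ (sign K) (+ [ K ]) (+ count (Q K) xs)) ⟨
    ∑ R (λ K → sign K * (+ [ K ] + + count (Q K) xs))
      ≡⟨ ∑-cong R (λ K _ → cong (sign K *_) (trans (cong +_ (count-∷ (Q K) x xs))
                                                    (pos-+ [ K ] (count (Q K) xs)))) ⟨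
    ∑ R (λ K → sign K * + count (Q K) (x ∷ xs)) ∎
    where
    open ≡-Reasoning
    Q : ℕ → X → Bool
    Q K y = P y ∧ (K ≤ᵇ t y)
    [_] : ℕ → ℕ
    [ K ] = if Q K x then 1 else 0
    head-term : ∀ b → + (if b ∧ even? (t x) then 1 else 0)
                        ≡ ∑ R (λ K → sign K * + (if b ∧ (K ≤ᵇ t x) then 1 else 0))
    head-term true  = trans (pos-indicator (even? (t x))) (even-indicator (t x) R (t<R x))
    head-term false = sym (∑-zero R (λ K _ → *-zeroʳ (sign K)))

  p-alternating : ∀ g d n R → suc n < R →
    pSeries (suc g) (suc d) n ≡ ∑ R (λ K → sign K * shift (expo (suc g) (suc d) K) (+_ ∘ partitions) n)
  p-alternating g d n R 1+n<R =
    trans (count-even (λ m → weightFrom 1 m ≡ᵇ n) (mexIdx (suc g) (suc d) n) R (lists n n)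
                      (λ m → ≤-<-trans (mexIdx-≤ (suc g) (suc d) n m) 1+n<R))
          (∑-cong R (λ K _ → cong (sign K *_)
            (trans (cong +_ (count-mex-≥ d g n K)) (pos-shift (expo (suc g) (suc d) K) partitions n))))

  theta-as-∑ : ∀ A a .{{_ : NonZero a}} N →
               thetaSeries A a N ≡ ∑ (suc (suc N)) (λ K → sign K * shift (expo A a K) δ N)
  theta-as-∑ A a N = begin
    thetaSeries A a N
      ≡⟨ thetaSeries-as-∑ A a N ⟩
    ∑ (suc N) (λ K → if expo A a K ≡ᵇ N then sign K else 0ℤ)
      ≡⟨ ∑-cong (suc N) (λ K _ → trans (cong (sign K *_) (shift-δ (expo A a K) N))
                                       (*-indicator (sign K) _)) ⟨
    ∑ (suc N) (λ K → sign K * shift (expo A a K) δ N)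
      ≡⟨ ∑-truncate (n≤1+n (suc N)) (λ K N<K _ →
           trans (cong (sign K *_) (shift-> δ (<-≤-trans N<K (expo-≥ A a K)))) (*-zeroʳ (sign K))) ⟨
    ∑ (suc (suc N)) (λ K → sign K * shift (expo A a K) δ N) ∎
    where open ≡-Reasoning

open import Data.Integer using (+_; _*_)
open import Data.Integer.Properties using (+-0-isCommutativeMonoid)
open Sums +-0-isCommutativeMonoid using (∑; ∑-cong; shift; shift-cong)
open Partitions using (partitions)
open PowerSeries using (conv; ⊛-as-conv; conv-congʳ; conv-∑ʳ; conv-shiftʳ; euler; δ)
open Alternation using (p-alternating; theta-as-∑)

theorem4p1 : (A a : ℕ) → 1 ≤ A → 1 ≤ a →
    (N : ℕ) → (qPochInf ⊛ pSeries A a) N ≡ thetaSeries A a N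
theorem4p1 zero    a       ()  _   N
theorem4p1 (suc g) zero    _   ()  N
theorem4p1 (suc g) (suc d) _   _   N = begin
  (qPochInf ⊛ pSeries A a) N
    ≡⟨ ⊛-as-conv qPochInf (pSeries A a) N ⟩
  conv qPochInf (pSeries A a) N
    ≡⟨ conv-congʳ qPochInf N (λ n n≤N → p-alternating g d n R (s≤s (s≤s n≤N))) ⟩
  conv qPochInf (λ n → ∑ R (λ K → sign K * shift (expo A a K) P n)) N
    ≡⟨ conv-∑ʳ R sign qPochInf (λ K → shift (expo A a K) P) N ⟩
  ∑ R (λ K → sign K * conv qPochInf (shift (expo A a K) P) N)
    ≡⟨ ∑-cong R (λ K _ → cong (sign K *_) (trans (conv-shiftʳ (expo A a K) qPochInf P N)
                                                  (shift-cong (expo A a K) (λ n _ → euler n)))) ⟩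
  ∑ R (λ K → sign K * shift (expo A a K) δ N)
    ≡⟨ theta-as-∑ A a N ⟨
  thetaSeries A a N ∎
  where
  open ≡-Reasoning
  A a R : ℕ
  A = suc g
  a = suc d
  R = suc (suc N)
  P : Series
  P = +_ ∘ partitions
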